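{- For every $d\geq 2$, the lattices $\mathcal{NC}_{G(d,d,2)}$ and $\mathcal{NC}_{G(d,d,3)}$ admit a symmetric Boolean decomposition.
   Context: $G(d,d,n)$ is the group of $n\times n$ monomial matrices with $d$-th roots of unity as nonzero entries whose product is $1$. With $T$ its set of reflections, $\ell_T$ is reflection length and $u\leq_T v$ iff $\ell_T(v)=\ell_T(u)+\ell_T(u^{ -1}v)$. $\mathcal{NC}_{G(d,d,n)}=\{u:\varepsilon\leq_T u\leq_T c\}$ for a Coxeter element $c$ (a $\zeta$-regular element of order equal to the largest degree; isomorphism type independent of $c$), graded by $\ell_T$. A decomposition of a finite poset $P$ is a partition into parts $D$ such that each induced subposet $(D,\leq)$ is not a disjoint union of two or more nonempty subposets with no comparabilities between them, and each cover relation of $(D,\leq)$ is a cover relation of $P$; for $P$ graded of rank $n$ it is symmetric if for each part there is a bijection from minimal to maximal elements with corresponding $p,q$ satisfying $\mathrm{rk}(p)+\mathrm{rk}(q)=n$; a symmetric Boolean decomposition is one whose parts are Boolean lattices. -}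

module Defs where

open import Data.Nat using (ℕ; zero; suc; _+_; _∸_; NonZero)
open import Data.Nat.DivMod using (_mod_)
open import Data.Fin using (Fin; toℕ; _≟_)
open import Data.Fin.Subset using (Subset; _⊆_)
open import Data.Vec using (Vec; tabulate; lookup; replicate; _∷_; [])
open import Data.List using (List; []; _∷_; length)
open import Data.List.Relation.Unary.All using (All)
open import Data.Bool using (Bool; true; false)
open import Data.Product using (Σ; ∃; ∃₂; _×_; _,_)
open import Data.Sum using (_⊎_)
open import Data.Empty using (⊥)
open import Relation.Nullary using (¬_; yes; no)
open import Relation.Binary.PropositionalEquality using (_≡_; _≢_)
open import Function using (id)

-- Generic notions for a finite poset given as a predicate InP on a
-- carrier A, with order _≤_, rank relation Rk (Rk x r : "x has rank r")
-- and RankP r : "the poset has rank r".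

module Decomposition {A : Set} (InP : A → Set) (_≤_ : A → A → Set)
                     (Rk : A → ℕ → Set) (RankP : ℕ → Set) where

  _<_ : A → A → Set
  x < y = x ≤ y × x ≢ y

  CoverIn : (A → Set) → A → A → Set
  CoverIn Q x y = Q x × Q y × x < y × (∀ z → Q z → x < z → z < y → ⊥)

  -- (Q, ≤) is not a disjoint union of two (or more) nonempty subposets
  -- with no comparabilities between them
  Connected : (A → Set) → Set
  Connected Q = ∀ (S : A → Bool) →
    (∃ λ x → Q x × S x ≡ true) → (∃ λ y → Q y × S y ≡ false) →
    ∃₂ λ x y → Q x × Q y × S x ≡ true × S y ≡ false × (x ≤ y ⊎ y ≤ x)

  CoverPreserving : (A → Set) → Set
  CoverPreserving Q = ∀ x y → CoverIn Q x y → CoverIn InP x y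

  IsBoolean : (A → Set) → Set
  IsBoolean Q = Σ ℕ λ k → Σ (Subset k → A) λ f →
      (∀ X → Q (f X))
    × (∀ x → Q x → ∃ λ X → f X ≡ x)
    × (∀ X Y → (X ⊆ Y → f X ≤ f Y) × (f X ≤ f Y → X ⊆ Y))

  Minimal Maximal : (A → Set) → A → Set
  Minimal Q x = Q x × (∀ y → Q y → y < x → ⊥)
  Maximal Q x = Q x × (∀ y → Q y → x < y → ⊥)

  IsSymmetricPart : (A → Set) → Set
  IsSymmetricPart Q = Σ (A → A) λ g →
      (∀ x → Minimal Q x → Maximal Q (g x))
    × (∀ x y → Minimal Q x → Minimal Q y → g x ≡ g y → x ≡ y)
    × (∀ y → Maximal Q y → ∃ λ x → Minimal Q x × g x ≡ y)
    × (∀ x → Minimal Q x → ∀ a b r → Rk x a → Rk (g x) b → RankP r → a + b ≡ r)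

  IsPartition : (m : ℕ) → (Fin m → A → Set) → Set
  IsPartition m Part =
      (∀ i x → Part i x → InP x)
    × (∀ x → InP x → ∃ λ i → Part i x)
    × (∀ i j x → Part i x → Part j x → i ≡ j)
    × (∀ i → ∃ λ x → Part i x)

  SymmetricBooleanDecomposition : Set₁
  SymmetricBooleanDecomposition =
    Σ ℕ λ m → Σ (Fin m → A → Set) λ Part →
      IsPartition m Part
    × (∀ i → Connected (Part i) × CoverPreserving (Part i)
           × IsBoolean (Part i) × IsSymmetricPart (Part i))

-- An element (σ , a) with σ : Vec (Fin n) n (a permutation) and
-- a : Vec (Fin d) n stands for the monomial matrix M with
-- M[i][σ i] = ζ^(a i) (ζ = e^{2πi/d}), all other entries 0.
-- Membership in G(d,d,n) means σ is a permutation and Σ a ≡ 0 mod d;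
-- every product of reflections is automatically of that form.

Elem : ℕ → ℕ → Set
Elem n d = Vec (Fin n) n × Vec (Fin d) n

module GroupGdd (n d : ℕ) .{{_ : NonZero d}} where

  _+d_ : Fin d → Fin d → Fin d
  a +d b = (toℕ a + toℕ b) mod d

  negd : Fin d → Fin d
  negd a = (d ∸ toℕ a) mod d

  0d : Fin d
  0d = 0 mod d

  -- matrix product: (MN)[i][τ(σ i)] = ζ^(a i + b (σ i))
  _·_ : Elem n d → Elem n d → Elem n d
  (σ , a) · (τ , b) =
    tabulate (λ i → lookup τ (lookup σ i)) ,
    tabulate (λ i → lookup a i +d lookup b (lookup σ i))

  ε : Elem n d
  ε = tabulate id , replicate n 0d

  prod : List (Elem n d) → Elem n d
  prod [] = ε
  prod (t ∷ ts) = t · prod ts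

  swap : Fin n → Fin n → Fin n → Fin n
  swap i j x with x ≟ i
  ... | yes _ = j
  ... | no _ with x ≟ j
  ...   | yes _ = i
  ...   | no _ = x

  wt : Fin n → Fin n → Fin d → Fin n → Fin d
  wt i j k x with x ≟ i
  ... | yes _ = k
  ... | no _ with x ≟ j
  ...   | yes _ = negd k
  ...   | no _ = 0d

  reflection : Fin n → Fin n → Fin d → Elem n d
  reflection i j k = tabulate (swap i j) , tabulate (wt i j k)

  IsReflection : Elem n d → Set
  IsReflection t = ∃ λ i → ∃ λ j → ∃ λ k → i ≢ j × t ≡ reflection i j k

  ProductOfReflections : ℕ → Elem n d → Set
  ProductOfReflections k u =
    Σ (List (Elem n d)) λ ts → All IsReflection ts × length ts ≡ k × prod ts ≡ u

  ReflLength : Elem n d → ℕ → Set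
  ReflLength u k = ProductOfReflections k u
                 × (∀ m → suc m Data.Nat.≤ k → ¬ ProductOfReflections m u)

  -- u ≤_T v  iff  ℓ_T(v) = ℓ_T(u) + ℓ_T(u⁻¹v)   (w below is u⁻¹v)
  _≤T_ : Elem n d → Elem n d → Set
  u ≤T v = Σ (Elem n d) λ w → u · w ≡ v ×
           ∃₂ λ a b → ReflLength u a × ReflLength w b × ReflLength v (a + b)

  InNC : Elem n d → Elem n d → Set
  InNC c u = ε ≤T u × u ≤T c

  HasSymmetricBooleanDecomposition : Elem n d → Set₁
  HasSymmetricBooleanDecomposition c =
    Decomposition.SymmetricBooleanDecomposition
      (InNC c) _≤T_ ReflLength (ReflLength c)

-- Standard Coxeter elements.
-- n = 2 : diag(ζ, ζ⁻¹), order d = largest degree of G(d,d,2).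
-- n = 3 : rows: e₀ ↦ col 1 weight 1, e₁ ↦ col 0 weight ζ, e₂ ↦ col 2
--         weight ζ⁻¹; order 2d = largest degree of G(d,d,3).

coxeter2 : (d : ℕ) .{{_ : NonZero d}} → Elem 2 d
coxeter2 d = (zero ∷ suc zero ∷ []) , (1 mod d ∷ (d ∸ 1) mod d ∷ [])
  where open Data.Fin using (zero; suc)

coxeter3 : (d : ℕ) .{{_ : NonZero d}} → Elem 3 d
coxeter3 d = (suc zero ∷ zero ∷ suc (suc zero) ∷ []) ,
             (0 mod d ∷ 1 mod d ∷ (d ∸ 1) mod d ∷ [])
  where open Data.Fin using (zero; suc)

-- NC(c) is graded by reflection length, of rank 2 for G(d,d,2) and 3 for G(d,d,3). The parts
-- are images of Boolean lattices of subsets under order embeddings with ranks ∣ X ∣ + b; such a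
-- part is cover preserving, and symmetric as soon as the ranks of its bottom and top add up to
-- the rank of c.
--
-- For n = 2, NC(c) consists of ε, c and all d reflections s k: take the square {ε, s 1, s 0, c}
-- and the singletons {s k}, k ≥ 2. For n = 3, the atoms of NC(c) are 2d + 2 reflections t and
-- its coatoms are the elements c · t; the parts are a cube from ε to c and 2d - 1 edges, each
-- joining an atom to a coatom above it. Elements are classified by two properties of a product
-- of two reflections: its permutation is even, and if it is diagonal one of its weights is 0.

module Submission where

open import Defs
open import Algebra.Bundles using (AbelianGroup)
open import Algebra.Structures using (IsAbelianGroup)
import Algebra.Properties.AbelianGroup as AbelianGroupProperties
open import Data.Bool using (true; false)
open import Data.Empty using (⊥-elim)
open import Data.Fin using (Fin; zero; suc; toℕ)
open import Data.Fin.Properties using (toℕ-injective; toℕ-fromℕ<; toℕ<n; +↔⊎)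
import Data.Fin.Properties as Fin
open import Data.Fin.Subset using (Subset; _⊆_; ∣_∣; inside; outside) renaming (⊥ to ∅; ⊤ to full)
open import Data.Fin.Subset.Properties
  using (_⊆?_; ⊆-min; ⊆⊤; ⊆-refl; out⊆; in⊆in; s⊆s; drop-∷-⊆; p⊆q⇒∣p∣≤∣q∣; ∣p∣≤n; ∣p∣≡n⇒p≡⊤; ∣⊥∣≡0; ∣⊤∣≡n)
open import Data.List using ([]; _∷_)
open import Data.List.Relation.Unary.All using ([]; _∷_)
open import Data.Nat using (ℕ; _+_; _∸_; _%_; _≤_; _<_; z≤n; s≤s; NonZero; >-nonZero⁻¹)
import Data.Nat as ℕ
open import Data.Nat.DivMod using (_mod_; m%n<n; m<n⇒m%n≡m; %-distribˡ-+; m%n%n≡m%n; n%n≡0)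
open import Data.Nat.Properties
  using (+-comm; +-assoc; +-identityʳ; ≤-refl; <-cmp; m≤m+n; m+n∸m≡n; n∸n≡0; m∸n+n≡m; <⇒≤; ≤-trans; ≤-antisym; ≤-pred;
         ≤∧≢⇒<; <⇒≱; <⇒≢; <-irrefl; ≤-<-trans; <-≤-trans; n≢0⇒n>0; +-cancelʳ-≤; +-cancelʳ-<; +-monoˡ-<)
open import Data.Product using (∃; ∃₂; _×_; _,_; proj₁; proj₂)
import Data.Product.Properties as Product
open import Data.Sum using (_⊎_; inj₁; inj₂)
open import Data.Vec using (Vec; []; _∷_; lookup; tabulate; here)
import Data.Vec.Properties as Vec
open import Data.Vec.Properties using (lookup∘tabulate; tabulate∘lookup; tabulate-cong; lookup-replicate)
open import Function using (_∘_)
open import Function.Bundles using (_⇔_; mk⇔; module Equivalence; _↔_; module Inverse)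
open import Function.Construct.Identity using (↔-id)
open import Level using (0ℓ)
open import Relation.Nullary using (¬_; yes; no)
open import Relation.Nullary.Decidable using (True; False; toWitness; toWitnessFalse)
open import Relation.Binary.Definitions using (DecidableEquality; tri<; tri≈; tri>)
open import Relation.Binary.PropositionalEquality
open ≡-Reasoning

Intermediate : ∀ {k} → Subset k → Set
Intermediate {k} X = 0 < ∣ X ∣ × ∣ X ∣ < k

∣p∣≡0⇒p≡∅ : ∀ {k} {p : Subset k} → ∣ p ∣ ≡ 0 → p ≡ ∅
∣p∣≡0⇒p≡∅ {p = []}          _  = refl
∣p∣≡0⇒p≡∅ {p = outside ∷ p} eq = cong (outside ∷_) (∣p∣≡0⇒p≡∅ eq)
∣p∣≡0⇒p≡∅ {p = inside ∷ p}  ()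

⊆-interpolate : ∀ {k} {p q : Subset k} → p ⊆ q → 2 + ∣ p ∣ ≤ ∣ q ∣ →
                ∃ λ r → p ⊆ r × r ⊆ q × ∣ p ∣ < ∣ r ∣ × ∣ r ∣ < ∣ q ∣
⊆-interpolate {p = []}          {[]}          _   ()
⊆-interpolate {p = inside ∷ _}  {outside ∷ _} p⊆q _ with p⊆q here
... | ()
⊆-interpolate {p = outside ∷ p} {inside ∷ q}  p⊆q gap =
  inside ∷ p , out⊆ ⊆-refl , in⊆in (drop-∷-⊆ p⊆q) , ≤-refl , gap
⊆-interpolate {p = outside ∷ _} {outside ∷ _} p⊆q gap with ⊆-interpolate (drop-∷-⊆ p⊆q) gap
... | r , p⊆r , r⊆q , p<r , r<q = outside ∷ r , s⊆s p⊆r , s⊆s r⊆q , p<r , r<q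
⊆-interpolate {p = inside ∷ _}  {inside ∷ _}  p⊆q (s≤s gap) with ⊆-interpolate (drop-∷-⊆ p⊆q) gap
... | r , p⊆r , r⊆q , p<r , r<q = inside ∷ r , s⊆s p⊆r , s⊆s r⊆q , s≤s p<r , s≤s r<q

small⇒¬Intermediate : ∀ {k} (X : Subset k) → k ≤ 1 → ¬ Intermediate X
small⇒¬Intermediate X k≤1 (0<∣X∣ , ∣X∣<k) = <-irrefl refl (≤-trans (s≤s 0<∣X∣) (≤-trans ∣X∣<k k≤1))

module AbsoluteOrder (n d : ℕ) .{{_ : NonZero d}} where

  open GroupGdd n d public

  -- The weights: the cyclic group of order d

  private
    toℕ-mod : ∀ m → toℕ (m mod d) ≡ m % d
    toℕ-mod m = toℕ-fromℕ< (m%n<n m d)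

    mod-cong : ∀ {m m′} → m % d ≡ m′ % d → m mod d ≡ m′ mod d
    mod-cong {m} {m′} eq = toℕ-injective (trans (toℕ-mod m) (trans eq (sym (toℕ-mod m′))))

    0%d≡0 : 0 % d ≡ 0
    0%d≡0 = m<n⇒m%n≡m (>-nonZero⁻¹ d)

    %-absorbˡ : ∀ m m′ → (m % d + m′) % d ≡ (m + m′) % d
    %-absorbˡ m m′ = begin
      (m % d + m′) % d           ≡⟨ %-distribˡ-+ (m % d) m′ d ⟩
      (m % d % d + m′ % d) % d   ≡⟨ cong (λ x → (x + m′ % d) % d) (m%n%n≡m%n m d) ⟩
      (m % d + m′ % d) % d       ≡⟨ %-distribˡ-+ m m′ d ⟨
      (m + m′) % d               ∎

    %-absorbʳ : ∀ m m′ → (m + m′ % d) % d ≡ (m + m′) % d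
    %-absorbʳ m m′ = begin
      (m + m′ % d) % d   ≡⟨ cong (_% d) (+-comm m (m′ % d)) ⟩
      (m′ % d + m) % d   ≡⟨ %-absorbˡ m′ m ⟩
      (m′ + m) % d       ≡⟨ cong (_% d) (+-comm m′ m) ⟩
      (m + m′) % d       ∎

  +d-assoc : ∀ a b c → (a +d b) +d c ≡ a +d (b +d c)
  +d-assoc a b c = mod-cong (begin
    (toℕ (a +d b) + toℕ c) % d          ≡⟨ cong (λ x → (x + toℕ c) % d) (toℕ-mod (toℕ a + toℕ b)) ⟩
    ((toℕ a + toℕ b) % d + toℕ c) % d   ≡⟨ %-absorbˡ (toℕ a + toℕ b) (toℕ c) ⟩
    (toℕ a + toℕ b + toℕ c) % d         ≡⟨ cong (_% d) (+-assoc (toℕ a) (toℕ b) (toℕ c)) ⟩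
    (toℕ a + (toℕ b + toℕ c)) % d       ≡⟨ %-absorbʳ (toℕ a) (toℕ b + toℕ c) ⟨
    (toℕ a + (toℕ b + toℕ c) % d) % d   ≡⟨ cong (λ x → (toℕ a + x) % d) (toℕ-mod (toℕ b + toℕ c)) ⟨
    (toℕ a + toℕ (b +d c)) % d          ∎)

  +d-comm : ∀ a b → a +d b ≡ b +d a
  +d-comm a b = cong (_mod d) (+-comm (toℕ a) (toℕ b))

  +d-identityˡ : ∀ a → 0d +d a ≡ a
  +d-identityˡ a = toℕ-injective (begin
    toℕ ((toℕ 0d + toℕ a) mod d)   ≡⟨ toℕ-mod (toℕ 0d + toℕ a) ⟩
    (toℕ 0d + toℕ a) % d           ≡⟨ cong (λ x → (x + toℕ a) % d) (trans (toℕ-mod 0) 0%d≡0) ⟩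
    toℕ a % d                      ≡⟨ m<n⇒m%n≡m (toℕ<n a) ⟩
    toℕ a                          ∎)

  negd-inverseˡ : ∀ a → negd a +d a ≡ 0d
  negd-inverseˡ a = mod-cong (begin
    (toℕ (negd a) + toℕ a) % d      ≡⟨ cong (λ x → (x + toℕ a) % d) (toℕ-mod (d ∸ toℕ a)) ⟩
    ((d ∸ toℕ a) % d + toℕ a) % d   ≡⟨ %-absorbˡ (d ∸ toℕ a) (toℕ a) ⟩
    (d ∸ toℕ a + toℕ a) % d         ≡⟨ cong (_% d) (m∸n+n≡m (<⇒≤ (toℕ<n a))) ⟩
    d % d                           ≡⟨ n%n≡0 d ⟩
    0                               ≡⟨ 0%d≡0 ⟨
    0 % d                           ∎)

  +d-isAbelianGroup : IsAbelianGroup _≡_ _+d_ 0d negd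
  +d-isAbelianGroup = record
    { isGroup = record
      { isMonoid = record
        { isSemigroup = record
          { isMagma = record { isEquivalence = isEquivalence ; ∙-cong = cong₂ _+d_ }
          ; assoc = +d-assoc
          }
        ; identity = +d-identityˡ , λ a → trans (+d-comm a 0d) (+d-identityˡ a)
        }
      ; inverse = negd-inverseˡ , λ a → trans (+d-comm a (negd a)) (negd-inverseˡ a)
      ; ⁻¹-cong = cong negd
      }
    ; comm = +d-comm
    }

  +d-abelianGroup : AbelianGroup 0ℓ 0ℓ
  +d-abelianGroup = record { isAbelianGroup = +d-isAbelianGroup }

  open AbelianGroup +d-abelianGroup public
    using () renaming (identityʳ to +d-identityʳ; inverseʳ to negd-inverseʳ)
  open AbelianGroupProperties +d-abelianGroup public
    using (ε⁻¹≈ε; ⁻¹-involutive; ⁻¹-injective; ⁻¹-∙-comm; inverseˡ-unique; inverseʳ-unique;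
           \\-leftDividesˡ; \\-leftDividesʳ; //-rightDividesˡ)

  ·-assoc : ∀ (u v w : Elem n d) → (u · v) · w ≡ u · (v · w)
  ·-assoc (σ , a) (τ , b) (ρ , c) = cong₂ _,_
    (tabulate-cong λ i →
      trans (cong (lookup ρ) (lookup∘tabulate (λ j → lookup τ (lookup σ j)) i))
            (sym (lookup∘tabulate (λ j → lookup ρ (lookup τ j)) (lookup σ i))))
    (tabulate-cong λ i →
      trans (cong₂ _+d_ (lookup∘tabulate (λ j → lookup a j +d lookup b (lookup σ j)) i)
                        (cong (lookup c) (lookup∘tabulate (λ j → lookup τ (lookup σ j)) i)))
      (trans (+d-assoc (lookup a i) (lookup b (lookup σ i)) (lookup c (lookup τ (lookup σ i))))
             (cong (lookup a i +d_) (sym (lookup∘tabulate (λ j → lookup b j +d lookup c (lookup τ j)) (lookup σ i))))))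

  ·-identityʳ : ∀ (u : Elem n d) → u · ε ≡ u
  ·-identityʳ (σ , a) = cong₂ _,_
    (trans (tabulate-cong λ i → lookup∘tabulate (λ j → j) (lookup σ i)) (tabulate∘lookup σ))
    (trans (tabulate-cong λ i → trans (cong (lookup a i +d_) (lookup-replicate (lookup σ i) 0d))
                                      (+d-identityʳ (lookup a i)))
           (tabulate∘lookup a))

  ·-identityˡ : ∀ (u : Elem n d) → ε · u ≡ u
  ·-identityˡ (σ , a) = cong₂ _,_
    (trans (tabulate-cong λ i → cong (lookup σ) (lookup∘tabulate (λ j → j) i)) (tabulate∘lookup σ))
    (trans (tabulate-cong λ i → trans (cong₂ _+d_ (lookup-replicate i 0d) (cong (lookup a) (lookup∘tabulate (λ j → j) i)))
                                      (+d-identityˡ (lookup a i)))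
           (tabulate∘lookup a))

  _≟ᴱ_ : DecidableEquality (Elem n d)
  _≟ᴱ_ = Product.≡-dec (Vec.≡-dec Fin._≟_) (Vec.≡-dec Fin._≟_)

  involution-cancelʳ : ∀ {t u v} → t · t ≡ ε → u · t ≡ v → u ≡ v · t
  involution-cancelʳ {t} {u} {v} tt≡ε ut≡v = begin
    u             ≡⟨ ·-identityʳ u ⟨
    u · ε         ≡⟨ cong (u ·_) tt≡ε ⟨
    u · (t · t)   ≡⟨ ·-assoc u t t ⟨
    (u · t) · t   ≡⟨ cong (_· t) ut≡v ⟩
    v · t         ∎

  involution-cancelˡ : ∀ {t u v} → t · t ≡ ε → t · u ≡ v → u ≡ t · v
  involution-cancelˡ {t} {u} {v} tt≡ε tu≡v = begin
    u             ≡⟨ ·-identityˡ u ⟨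
    ε · u         ≡⟨ cong (_· u) tt≡ε ⟨
    (t · t) · u   ≡⟨ ·-assoc t t u ⟩
    t · (t · u)   ≡⟨ cong (t ·_) tu≡v ⟩
    t · v         ∎

  -- Reflection length and the absolute order

  ProductOfReflections₀⇒≡ε : ∀ {u} → ProductOfReflections 0 u → u ≡ ε
  ProductOfReflections₀⇒≡ε ([] , [] , refl , refl) = refl

  ProductOfReflections₁⇒reflection : ∀ {u} → ProductOfReflections 1 u → IsReflection u
  ProductOfReflections₁⇒reflection ((t ∷ []) , (t∈T ∷ []) , refl , refl) =
    subst IsReflection (sym (·-identityʳ t)) t∈T

  ProductOfReflections₂⇒factors : ∀ {u} → ProductOfReflections 2 u →
                                  ∃₂ λ t t′ → IsReflection t × IsReflection t′ × t · t′ ≡ u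
  ProductOfReflections₂⇒factors ((t ∷ t′ ∷ []) , (t∈T ∷ t′∈T ∷ []) , refl , refl) =
    t , t′ , t∈T , t′∈T , cong (t ·_) (sym (·-identityʳ t′))

  ReflLength-unique : ∀ {u a b} → ReflLength u a → ReflLength u b → a ≡ b
  ReflLength-unique {a = a} {b} (pa , minimalᵃ) (pb , minimalᵇ) with <-cmp a b
  ... | tri< a<b _ _ = ⊥-elim (minimalᵇ a a<b pa)
  ... | tri≈ _ a≡b _ = a≡b
  ... | tri> _ _ b<a = ⊥-elim (minimalᵃ b b<a pb)

  ReflLength-ε : ReflLength ε 0
  ReflLength-ε = ([] , [] , refl , refl) , λ _ ()

  ReflLength₀⇒≡ε : ∀ {u} → ReflLength u 0 → u ≡ ε
  ReflLength₀⇒≡ε (p , _) = ProductOfReflections₀⇒≡ε p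

  ReflLength-reflection : ∀ {t} → IsReflection t → t ≢ ε → ReflLength t 1
  ReflLength-reflection {t} t∈T t≢ε = ((t ∷ []) , (t∈T ∷ []) , refl , ·-identityʳ t) , shorter
    where
    shorter : ∀ m → ℕ.suc m ≤ 1 → ¬ ProductOfReflections m t
    shorter 0 _ p = t≢ε (ProductOfReflections₀⇒≡ε p)
    shorter (ℕ.suc _) (s≤s ())

  ReflLength-product : ∀ {t t′ u} → IsReflection t → IsReflection t′ → t · t′ ≡ u →
                       u ≢ ε → ¬ IsReflection u → ReflLength u 2
  ReflLength-product {t} {t′} t∈T t′∈T tt′≡u u≢ε u∉T =
    ((t ∷ t′ ∷ []) , (t∈T ∷ t′∈T ∷ []) , refl , trans (cong (t ·_) (·-identityʳ t′)) tt′≡u) , shorter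
    where
    shorter : ∀ m → ℕ.suc m ≤ 2 → ¬ ProductOfReflections m _
    shorter 0 _ p = u≢ε (ProductOfReflections₀⇒≡ε p)
    shorter 1 _ p = u∉T (ProductOfReflections₁⇒reflection p)
    shorter (ℕ.suc (ℕ.suc _)) (s≤s (s≤s ()))

  ReflLength-≢ : ∀ {u v a b} → ReflLength u a → ReflLength v b → a ≢ b → u ≢ v
  ReflLength-≢ ru rv a≢b refl = a≢b (ReflLength-unique ru rv)

  ≤T-intro : ∀ {u w v a b} → u · w ≡ v → ReflLength u a → ReflLength w b → ReflLength v (a + b) → u ≤T v
  ≤T-intro {w = w} uw≡v ru rw rv = w , uw≡v , _ , _ , ru , rw , rv

  ≤T-refl : ∀ {u a} → ReflLength u a → u ≤T u
  ≤T-refl {u} {a} ru = ≤T-intro (·-identityʳ u) ru ReflLength-ε (subst (ReflLength u) (sym (+-identityʳ a)) ru)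

  ε≤T : ∀ {u a} → ReflLength u a → ε ≤T u
  ε≤T {u} ru = ≤T-intro (·-identityˡ u) ReflLength-ε ru ru

  ≤T-rank : ∀ {u v a b} → u ≤T v → ReflLength u a → ReflLength v b → a ≤ b
  ≤T-rank (_ , _ , a′ , b′ , ru′ , _ , rv′) ru rv
    rewrite ReflLength-unique ru ru′ | ReflLength-unique rv rv′ = m≤m+n a′ b′

  ≤T-complement : ∀ {u v a b} → u ≤T v → ReflLength u a → ReflLength v b →
                  ∃ λ w → u · w ≡ v × ReflLength w (b ∸ a)
  ≤T-complement (w , uw≡v , a′ , b′ , ru′ , rw , rv′) ru rv
    rewrite ReflLength-unique ru ru′ | ReflLength-unique rv rv′ =
    w , uw≡v , subst (ReflLength w) (sym (m+n∸m≡n a′ b′)) rw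

  ≤T-same-rank : ∀ {u v a} → u ≤T v → ReflLength u a → ReflLength v a → u ≡ v
  ≤T-same-rank {u} {v} {a} u≤v ru rv with ≤T-complement u≤v ru rv
  ... | w , uw≡v , rw = begin
    u       ≡⟨ ·-identityʳ u ⟨
    u · ε   ≡⟨ cong (u ·_) (ReflLength₀⇒≡ε (subst (ReflLength w) (n∸n≡0 a) rw)) ⟨
    u · w   ≡⟨ uw≡v ⟩
    v       ∎

  ≤T-antisym : ∀ {u v} → u ≤T v → v ≤T u → u ≡ v
  ≤T-antisym {v = v} u≤v@(_ , _ , _ , _ , ru , _ , rv) v≤u =
    ≤T-same-rank u≤v ru (subst (ReflLength v) (≤-antisym (≤T-rank v≤u rv ru) (≤T-rank u≤v ru rv)) rv)

  <T-rank : ∀ {u v a b} → u ≤T v → u ≢ v → ReflLength u a → ReflLength v b → a < b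
  <T-rank {v = v} u≤v u≢v ru rv =
    ≤∧≢⇒< (≤T-rank u≤v ru rv) (λ a≡b → u≢v (≤T-same-rank u≤v ru (subst (ReflLength v) (sym a≡b) rv)))

  same-rank⇒¬≤T : ∀ {u v a} → ReflLength u a → ReflLength v a → u ≢ v → ¬ u ≤T v
  same-rank⇒¬≤T ru rv u≢v u≤v = u≢v (≤T-same-rank u≤v ru rv)

  involution-quotient : ∀ {t v a b} → t · t ≡ ε → t ≤T v → ReflLength t a → ReflLength v (a + b) →
                        ReflLength (t · v) b
  involution-quotient {t} {a = a} {b} tt≡ε t≤v rt rv with ≤T-complement t≤v rt rv
  ... | w , tw≡v , rw = subst₂ ReflLength (involution-cancelˡ {t} tt≡ε tw≡v) (m+n∸m≡n a b) rw

  comparable : ∀ {k} {X Y : Subset k} {u v} → True (X ⊆? Y) → u ≤T v → X ⊆ Y ⇔ u ≤T v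
  comparable {X = X} {Y} X⊆Y u≤v = mk⇔ {A = X ⊆ Y} (λ _ → u≤v) (λ _ → toWitness X⊆Y)

  incomparable : ∀ {k} {X Y : Subset k} {u v} → False (X ⊆? Y) → ¬ u ≤T v → X ⊆ Y ⇔ u ≤T v
  incomparable {X = X} {Y} X⊈Y u≰v = mk⇔ {A = X ⊆ Y} (⊥-elim ∘ toWitnessFalse X⊈Y) (⊥-elim ∘ u≰v)

  -- Symmetric Boolean parts of NC(c)

  module NoncrossingParts (c : Elem n d) {r : ℕ} (rc : ReflLength c r) where

    open Decomposition (InNC c) _≤T_ ReflLength (ReflLength c) public hiding (_<_)

    Image : ∀ {k} → (Subset k → Elem n d) → Elem n d → Set
    Image f x = ∃ λ X → f X ≡ x

    IsSymmetricBooleanPart : (Elem n d → Set) → Set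
    IsSymmetricBooleanPart Q = Connected Q × CoverPreserving Q × IsBoolean Q × IsSymmetricPart Q

    InNC-rank : ∀ {x} → InNC c x → ∃ λ a → a ≤ r × ReflLength x a
    InNC-rank ((_ , _ , a , b , _ , _ , rx) , x≤c) = a + b , ≤T-rank x≤c rx rc , rx

    cover-by-rank : ∀ {x y a} → InNC c x → InNC c y → x ≤T y → x ≢ y →
                    ReflLength x a → ReflLength y (ℕ.suc a) → CoverIn (InNC c) x y
    cover-by-rank x∈ y∈ x≤y x≢y rx ry = x∈ , y∈ , (x≤y , x≢y) , λ z z∈ (x≤z , x≢z) (z≤y , z≢y) →
      let (_ , _ , rz) = InNC-rank z∈ in
      <⇒≱ (<T-rank x≤z x≢z rx rz) (≤-pred (<T-rank z≤y z≢y rz ry))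

    module BooleanPart {k : ℕ} (f : Subset k → Elem n d) (b : ℕ)
        (rank : ∀ X → ReflLength (f X) (∣ X ∣ + b))
        (inNC : ∀ X → InNC c (f X))
        (bottom-least : ∀ Y → f ∅ ≤T f Y)
        (top-greatest : ∀ X → f X ≤T f full)
        (intermediate : ∀ X Y → ∣ X ∣ ≤ ∣ Y ∣ → Intermediate X → Intermediate Y → X ⊆ Y ⇔ f X ≤T f Y)
        (rank-sum : b + (k + b) ≡ r) where

      embedding : ∀ X Y → X ⊆ Y ⇔ f X ≤T f Y
      embedding X Y with ∣ X ∣ ℕ.≟ 0 | ∣ Y ∣ ℕ.≟ k
      ... | yes ∣X∣≡0 | _ = subst (λ Z → Z ⊆ Y ⇔ f Z ≤T f Y) (sym (∣p∣≡0⇒p≡∅ ∣X∣≡0))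
                                  (mk⇔ {A = ∅ ⊆ Y} (λ _ → bottom-least Y) (λ _ → ⊆-min Y))
      ... | no _ | yes ∣Y∣≡k = subst (λ Z → X ⊆ Z ⇔ f X ≤T f Z) (sym (∣p∣≡n⇒p≡⊤ ∣Y∣≡k))
                                    (mk⇔ {A = X ⊆ full} (λ _ → top-greatest X) (λ _ → ⊆⊤))
      ... | no ∣X∣≢0 | no ∣Y∣≢k =
        mk⇔ {A = X ⊆ Y} (λ X⊆Y → Equivalence.to (between (p⊆q⇒∣p∣≤∣q∣ X⊆Y)) X⊆Y)
            (λ fX≤fY → Equivalence.from (between (+-cancelʳ-≤ b _ _ (≤T-rank fX≤fY (rank X) (rank Y)))) fX≤fY)
        where
        between : ∣ X ∣ ≤ ∣ Y ∣ → X ⊆ Y ⇔ f X ≤T f Y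
        between ∣X∣≤∣Y∣ = intermediate X Y ∣X∣≤∣Y∣ (0<∣X∣ , ≤-<-trans ∣X∣≤∣Y∣ ∣Y∣<k) (<-≤-trans 0<∣X∣ ∣X∣≤∣Y∣ , ∣Y∣<k)
          where
          0<∣X∣ = n≢0⇒n>0 ∣X∣≢0
          ∣Y∣<k = ≤∧≢⇒< (∣p∣≤n Y) ∣Y∣≢k

      strictly-below : ∀ {X Z} → X ⊆ Z → ∣ X ∣ < ∣ Z ∣ → f X ≤T f Z × f X ≢ f Z
      strictly-below {X} {Z} X⊆Z ∣X∣<∣Z∣ =
        Equivalence.to (embedding X Z) X⊆Z , ReflLength-≢ (rank X) (rank Z) (<⇒≢ (+-monoˡ-< b ∣X∣<∣Z∣))

      -- The ranks in the part are ∣ X ∣ + b, and a cover of the part that skipped a rank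
      -- would leave room for an intermediate subset.
      coverPreserving : CoverPreserving (Image f)
      coverPreserving _ _ ((X , refl) , (Y , refl) , (fX≤fY , fX≢fY) , nothing-between) =
        cover-by-rank (inNC X) (inNC Y) fX≤fY fX≢fY (rank X) (subst (λ m → ReflLength (f Y) (m + b)) ∣Y∣≡1+∣X∣ (rank Y))
        where
        X⊆Y = Equivalence.from (embedding X Y) fX≤fY
        ∣X∣<∣Y∣ = +-cancelʳ-< b _ _ (<T-rank fX≤fY fX≢fY (rank X) (rank Y))
        ∣Y∣≡1+∣X∣ : ∣ Y ∣ ≡ ℕ.suc ∣ X ∣
        ∣Y∣≡1+∣X∣ with ∣ Y ∣ ℕ.≟ ℕ.suc ∣ X ∣
        ... | yes eq = eq
        ... | no neq with ⊆-interpolate X⊆Y (≤∧≢⇒< ∣X∣<∣Y∣ (neq ∘ sym))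
        ...   | Z , X⊆Z , Z⊆Y , ∣X∣<∣Z∣ , ∣Z∣<∣Y∣ =
          ⊥-elim (nothing-between (f Z) (Z , refl) (strictly-below X⊆Z ∣X∣<∣Z∣) (strictly-below Z⊆Y ∣Z∣<∣Y∣))

      isBoolean : IsBoolean (Image f)
      isBoolean = k , f , (λ X → X , refl) , (λ _ x∈ → x∈) ,
                  λ X Y → Equivalence.to (embedding X Y) , Equivalence.from (embedding X Y)

      bottom-below : ∀ x → Image f x → f ∅ ≤T x
      bottom-below _ (X , refl) = bottom-least X

      top-above : ∀ x → Image f x → x ≤T f full
      top-above _ (X , refl) = top-greatest X

      bottom-minimal : Minimal (Image f) (f ∅)
      bottom-minimal = (∅ , refl) , λ y y∈ (y≤ , y≢) → y≢ (≤T-antisym y≤ (bottom-below y y∈))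

      top-maximal : Maximal (Image f) (f full)
      top-maximal = (full , refl) , λ y y∈ (≤y , ≢y) → ≢y (≤T-antisym ≤y (top-above y y∈))

      minimal⇒bottom : ∀ x → Minimal (Image f) x → x ≡ f ∅
      minimal⇒bottom x (x∈ , minimal) with x ≟ᴱ f ∅
      ... | yes x≡bottom = x≡bottom
      ... | no x≢bottom = ⊥-elim (minimal (f ∅) (∅ , refl) (bottom-below x x∈ , x≢bottom ∘ sym))

      maximal⇒top : ∀ x → Maximal (Image f) x → x ≡ f full
      maximal⇒top x (x∈ , maximal) with x ≟ᴱ f full
      ... | yes x≡top = x≡top
      ... | no x≢top = ⊥-elim (maximal (f full) (full , refl) (top-above x x∈ , x≢top))

      connected : Connected (Image f)
      connected S (x , x∈ , Sx≡true) (y , y∈ , Sy≡false) with S (f ∅) in Sbottom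
      ... | true  = f ∅ , y , (∅ , refl) , y∈ , Sbottom , Sy≡false , inj₁ (bottom-below y y∈)
      ... | false = x , f ∅ , x∈ , (∅ , refl) , Sx≡true , Sbottom , inj₂ (bottom-below x x∈)

      isSymmetricPart : IsSymmetricPart (Image f)
      isSymmetricPart =
          (λ _ → f full)
        , (λ _ _ → top-maximal)
        , (λ x y x-min y-min _ → trans (minimal⇒bottom x x-min) (sym (minimal⇒bottom y y-min)))
        , (λ y y-max → f ∅ , bottom-minimal , sym (maximal⇒top y y-max))
        , λ x x-min a a′ r′ rx rtop rc′ → begin
            a + a′        ≡⟨ cong₂ _+_ (ReflLength-unique (subst (λ z → ReflLength z a) (minimal⇒bottom x x-min) rx) rank-bottom)
                                       (ReflLength-unique rtop rank-top) ⟩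
            b + (k + b)   ≡⟨ rank-sum ⟩
            r             ≡⟨ ReflLength-unique rc rc′ ⟩
            r′            ∎
        where
        rank-bottom : ReflLength (f ∅) b
        rank-bottom = subst (λ m → ReflLength (f ∅) (m + b)) (∣⊥∣≡0 k) (rank ∅)
        rank-top : ReflLength (f full) (k + b)
        rank-top = subst (λ m → ReflLength (f full) (m + b)) (∣⊤∣≡n k) (rank full)

      isSymmetricBooleanPart : IsSymmetricBooleanPart (Image f)
      isSymmetricBooleanPart = connected , coverPreserving , isBoolean , isSymmetricPart

    point : Elem n d → Subset 0 → Elem n d
    point x [] = x

    pointPart : ∀ {x a} → InNC c x → ReflLength x a → a + a ≡ r → IsSymmetricBooleanPart (Image (point x))
    pointPart {x} {a} x∈ rx a+a≡r =
      BooleanPart.isSymmetricBooleanPart (point x) a rank (λ { [] → x∈ })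
        (λ { [] → ≤T-refl rx }) (λ { [] → ≤T-refl rx }) (λ X _ _ X-int _ → ⊥-elim (small⇒¬Intermediate X z≤n X-int)) a+a≡r
      where
      rank : ∀ X → ReflLength (point x X) (∣ X ∣ + a)
      rank [] = rx

    edge : Elem n d → Elem n d → Subset 1 → Elem n d
    edge x y (outside ∷ []) = x
    edge x y (inside ∷ [])  = y

    edgePart : ∀ {x y a} → InNC c x → InNC c y → ReflLength x a → ReflLength y (ℕ.suc a) → x ≤T y →
               a + ℕ.suc a ≡ r → IsSymmetricBooleanPart (Image (edge x y))
    edgePart {x} {y} {a} x∈ y∈ rx ry x≤y rank-sum =
      BooleanPart.isSymmetricBooleanPart (edge x y) a rank inNC bottom-least top-greatest
        (λ X _ _ X-int _ → ⊥-elim (small⇒¬Intermediate X ≤-refl X-int)) rank-sum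
      where
      rank : ∀ X → ReflLength (edge x y X) (∣ X ∣ + a)
      rank (outside ∷ []) = rx
      rank (inside ∷ [])  = ry
      inNC : ∀ X → InNC c (edge x y X)
      inNC (outside ∷ []) = x∈
      inNC (inside ∷ [])  = y∈
      bottom-least : ∀ Y → x ≤T edge x y Y
      bottom-least (outside ∷ []) = ≤T-refl rx
      bottom-least (inside ∷ [])  = x≤y
      top-greatest : ∀ X → edge x y X ≤T y
      top-greatest (outside ∷ []) = x≤y
      top-greatest (inside ∷ [])  = ≤T-refl ry

    module Assembly {I : Set} {m : ℕ} (index : Fin m ↔ I) (size : I → ℕ)
        (part : (i : I) → Subset (size i) → Elem n d)
        (locate : Elem n d → I) (locate-part : ∀ i X → locate (part i X) ≡ i)
        (part-inNC : ∀ i X → InNC c (part i X))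
        (classify : ∀ x → InNC c x → ∃ λ i → Image (part i) x)
        (symmetricBoolean : ∀ i → IsSymmetricBooleanPart (Image (part i))) where

      open Inverse index

      Part : Fin m → Elem n d → Set
      Part j = Image (part (to j))

      disjoint : ∀ j j′ x → Part j x → Part j′ x → j ≡ j′
      disjoint j j′ _ (X , refl) (X′ , eq) = begin
        j                                ≡⟨ strictlyInverseʳ j ⟨
        from (to j)                      ≡⟨ cong from (locate-part (to j) X) ⟨
        from (locate (part (to j) X))    ≡⟨ cong (from ∘ locate) eq ⟨
        from (locate (part (to j′) X′))  ≡⟨ cong from (locate-part (to j′) X′) ⟩
        from (to j′)                     ≡⟨ strictlyInverseʳ j′ ⟩
        j′                               ∎

      covered : ∀ x → InNC c x → ∃ λ j → Part j x
      covered x x∈ with classify x x∈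
      ... | i , x∈i = from i , subst (λ i′ → Image (part i′) x) (sym (strictlyInverseˡ i)) x∈i

      decomposition : SymmetricBooleanDecomposition
      decomposition =
        m , Part ,
        ((λ { j _ (X , refl) → part-inNC (to j) X }) , covered , disjoint , λ j → part (to j) ∅ , ∅ , refl) ,
        λ j → symmetricBoolean (to j)

module Gdd2 (e : ℕ) where

  d : ℕ
  d = 2 + e

  open AbsoluteOrder 2 d

  1d -1d : Fin d
  1d = suc zero
  -1d = negd 1d

  c : Elem 2 d
  c = coxeter2 d

  s : Fin d → Elem 2 d
  s = reflection zero (suc zero)

  weights≡ : ∀ {σ a₀ a₁ b₀ b₁} → a₀ ≡ b₀ → a₁ ≡ b₁ → _≡_ {A = Elem 2 d} (σ , a₀ ∷ a₁ ∷ []) (σ , b₀ ∷ b₁ ∷ [])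
  weights≡ refl refl = refl

  s-reflection : ∀ k → IsReflection (s k)
  s-reflection k = zero , suc zero , k , (λ ()) , refl

  ReflLength-s : ∀ k → ReflLength (s k) 1
  ReflLength-s k = ReflLength-reflection (s-reflection k) (λ ())

  reflection-normal : ∀ {t} → IsReflection t → ∃ λ k → t ≡ s k
  reflection-normal (zero , zero , _ , i≢j , _) = ⊥-elim (i≢j refl)
  reflection-normal (zero , suc zero , k , _ , refl) = k , refl
  reflection-normal (suc zero , zero , k , _ , refl) = negd k , weights≡ refl (sym (⁻¹-involutive k))
  reflection-normal (suc zero , suc zero , _ , i≢j , _) = ⊥-elim (i≢j refl)

  c-factorisation : s 1d · s zero ≡ c
  c-factorisation = weights≡ (trans (cong (1d +d_) ε⁻¹≈ε) (+d-identityʳ 1d)) (+d-identityʳ -1d)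

  ReflLength-c : ReflLength c 2
  ReflLength-c = ReflLength-product (s-reflection 1d) (s-reflection zero) c-factorisation (λ ()) c∉T
    where
    c∉T : ¬ IsReflection c
    c∉T c∈T with reflection-normal c∈T
    ... | _ , ()

  s∈NC : ∀ k → InNC c (s k)
  s∈NC k = ε≤T (ReflLength-s k) , ≤T-intro s·s≡c (ReflLength-s k) (ReflLength-s (k +d -1d)) ReflLength-c
    where
    s·s≡c : s k · s (k +d -1d) ≡ c
    s·s≡c = weights≡
      (begin
        k +d negd (k +d -1d)        ≡⟨ cong (k +d_) (⁻¹-∙-comm k -1d) ⟨
        k +d (negd k +d negd -1d)   ≡⟨ \\-leftDividesˡ k (negd -1d) ⟩
        negd -1d                    ≡⟨ ⁻¹-involutive 1d ⟩
        1d                          ∎)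
      (\\-leftDividesʳ k -1d)

  open NoncrossingParts c ReflLength-c

  square : Subset 2 → Elem 2 d
  square (outside ∷ outside ∷ []) = ε
  square (inside  ∷ outside ∷ []) = s 1d
  square (outside ∷ inside  ∷ []) = s zero
  square (inside  ∷ inside  ∷ []) = c

  square-rank : ∀ X → ReflLength (square X) (∣ X ∣ + 0)
  square-rank (outside ∷ outside ∷ []) = ReflLength-ε
  square-rank (inside  ∷ outside ∷ []) = ReflLength-s 1d
  square-rank (outside ∷ inside  ∷ []) = ReflLength-s zero
  square-rank (inside  ∷ inside  ∷ []) = ReflLength-c

  square-inNC : ∀ X → InNC c (square X)
  square-inNC (outside ∷ outside ∷ []) = ≤T-refl ReflLength-ε , ε≤T ReflLength-c
  square-inNC (inside  ∷ outside ∷ []) = s∈NC 1d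
  square-inNC (outside ∷ inside  ∷ []) = s∈NC zero
  square-inNC (inside  ∷ inside  ∷ []) = ε≤T ReflLength-c , ≤T-refl ReflLength-c

  square-intermediate : ∀ X Y → ∣ X ∣ ≤ ∣ Y ∣ → Intermediate X → Intermediate Y → X ⊆ Y ⇔ square X ≤T square Y
  square-intermediate (outside ∷ outside ∷ []) _ _ (() , _) _
  square-intermediate (inside  ∷ inside  ∷ []) _ _ (_ , s≤s (s≤s ())) _
  square-intermediate (inside  ∷ outside ∷ []) (outside ∷ outside ∷ []) () _ _
  square-intermediate (inside  ∷ outside ∷ []) (inside  ∷ outside ∷ []) _ _ _ = comparable _ (≤T-refl (ReflLength-s 1d))
  square-intermediate (inside  ∷ outside ∷ []) (outside ∷ inside  ∷ []) _ _ _ =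
    incomparable _ (same-rank⇒¬≤T (ReflLength-s 1d) (ReflLength-s zero) λ ())
  square-intermediate (inside  ∷ outside ∷ []) (inside  ∷ inside  ∷ []) _ _ (_ , s≤s (s≤s ()))
  square-intermediate (outside ∷ inside  ∷ []) (outside ∷ outside ∷ []) () _ _
  square-intermediate (outside ∷ inside  ∷ []) (inside  ∷ outside ∷ []) _ _ _ =
    incomparable _ (same-rank⇒¬≤T (ReflLength-s zero) (ReflLength-s 1d) λ ())
  square-intermediate (outside ∷ inside  ∷ []) (outside ∷ inside  ∷ []) _ _ _ = comparable _ (≤T-refl (ReflLength-s zero))
  square-intermediate (outside ∷ inside  ∷ []) (inside  ∷ inside  ∷ []) _ _ (_ , s≤s (s≤s ()))

  size : Fin (ℕ.suc e) → ℕ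
  size zero    = 2
  size (suc _) = 0

  part : (i : Fin (ℕ.suc e)) → Subset (size i) → Elem 2 d
  part zero    = square
  part (suc k) = point (s (suc (suc k)))

  -- Only the values on NC(c) matter.
  locate : Elem 2 d → Fin (ℕ.suc e)
  locate (_ , suc (suc k) ∷ _ ∷ []) = suc k
  locate _                          = zero

  locate-part : ∀ i X → locate (part i X) ≡ i
  locate-part zero    (outside ∷ outside ∷ []) = refl
  locate-part zero    (inside  ∷ outside ∷ []) = refl
  locate-part zero    (outside ∷ inside  ∷ []) = refl
  locate-part zero    (inside  ∷ inside  ∷ []) = refl
  locate-part (suc k) []                       = refl

  part-inNC : ∀ i X → InNC c (part i X)
  part-inNC zero    X  = square-inNC X
  part-inNC (suc k) [] = s∈NC (suc (suc k))

  locate-s : ∀ k → ∃ λ i → Image (part i) (s k)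
  locate-s zero          = zero , (outside ∷ inside ∷ []) , refl
  locate-s (suc zero)    = zero , (inside ∷ outside ∷ []) , refl
  locate-s (suc (suc k)) = suc k , [] , refl

  classify : ∀ x → InNC c x → ∃ λ i → Image (part i) x
  classify x x∈@(_ , x≤c) with InNC-rank x∈
  ... | 0 , _ , rx = zero , ∅ , sym (ReflLength₀⇒≡ε rx)
  ... | 1 , _ , rx with reflection-normal (ProductOfReflections₁⇒reflection (proj₁ rx))
  ...   | k , refl = locate-s k
  classify x x∈@(_ , x≤c) | 2 , _ , rx = zero , full , sym (≤T-same-rank x≤c rx ReflLength-c)
  classify x x∈@(_ , x≤c) | ℕ.suc (ℕ.suc (ℕ.suc _)) , s≤s (s≤s ()) , _

  parts : ∀ i → IsSymmetricBooleanPart (Image (part i))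
  parts zero    = BooleanPart.isSymmetricBooleanPart square 0 square-rank square-inNC
                    (λ Y → ε≤T (square-rank Y)) (λ X → proj₂ (square-inNC X)) square-intermediate refl
  parts (suc k) = pointPart (s∈NC (suc (suc k))) (ReflLength-s (suc (suc k))) refl

  decomposition : GroupGdd.HasSymmetricBooleanDecomposition 2 d c
  decomposition = Assembly.decomposition (↔-id _) size part locate locate-part part-inNC classify parts

module Gdd3 (e : ℕ) where

  d : ℕ
  d = 2 + e

  open AbsoluteOrder 3 d

  1d -1d : Fin d
  1d = suc zero
  -1d = negd 1d

  -1d≢0 : -1d ≢ zero
  -1d≢0 -1d≡0 with ⁻¹-injective {1d} {zero} (trans -1d≡0 (sym ε⁻¹≈ε))
  ... | ()

  c : Elem 3 d
  c = coxeter3 d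

  data Transposition : Set where
    τ₀₁ τ₀₂ τ₁₂ : Transposition

  r : Transposition → Fin d → Elem 3 d
  r τ₀₁ = reflection zero (suc zero)
  r τ₀₂ = reflection zero (suc (suc zero))
  r τ₁₂ = reflection (suc zero) (suc (suc zero))

  fixed : Transposition → Fin 3
  fixed τ₀₁ = suc (suc zero)
  fixed τ₀₂ = suc zero
  fixed τ₁₂ = zero

  pattern id₃  = zero ∷ suc zero ∷ suc (suc zero) ∷ []
  pattern rot  = suc zero ∷ suc (suc zero) ∷ zero ∷ []
  pattern rot² = suc (suc zero) ∷ zero ∷ suc zero ∷ []
  pattern π₀₁  = suc zero ∷ zero ∷ suc (suc zero) ∷ []
  pattern π₀₂  = suc (suc zero) ∷ suc zero ∷ zero ∷ []
  pattern π₁₂  = zero ∷ suc (suc zero) ∷ suc zero ∷ []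

  -- The elements of rank 2 below c: D₀ = c · r τ₀₁ 0, D₁ = c · r τ₀₁ (-1),
  -- A (1 + k) = c · r τ₀₂ k and B j = c · r τ₁₂ j.
  D₀ D₁ : Elem 3 d
  D₀ = id₃ , zero ∷ 1d ∷ -1d ∷ []
  D₁ = id₃ , 1d ∷ zero ∷ -1d ∷ []

  A B : Fin d → Elem 3 d
  A k = rot  , zero ∷ k ∷ negd k ∷ []
  B j = rot² , j ∷ 1d ∷ -1d +d negd j ∷ []

  weights≡ : ∀ {σ a₀ a₁ a₂ b₀ b₁ b₂} → a₀ ≡ b₀ → a₁ ≡ b₁ → a₂ ≡ b₂ →
             _≡_ {A = Elem 3 d} (σ , a₀ ∷ a₁ ∷ a₂ ∷ []) (σ , b₀ ∷ b₁ ∷ b₂ ∷ [])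
  weights≡ refl refl refl = refl

  -0+a≡a : ∀ a → negd zero +d a ≡ a
  -0+a≡a a = trans (cong (_+d a) ε⁻¹≈ε) (+d-identityˡ a)

  a-0≡a : ∀ a → a +d negd zero ≡ a
  a-0≡a a = trans (cong (a +d_) ε⁻¹≈ε) (+d-identityʳ a)

  0+-[-1]≡1 : zero +d negd -1d ≡ 1d
  0+-[-1]≡1 = trans (+d-identityˡ (negd -1d)) (⁻¹-involutive 1d)

  -[-1]+0≡1 : negd -1d +d zero ≡ 1d
  -[-1]+0≡1 = trans (+d-identityʳ (negd -1d)) (⁻¹-involutive 1d)

  k+-[k-1]≡1 : ∀ k → k +d negd (k +d -1d) ≡ 1d
  k+-[k-1]≡1 k = begin
    k +d negd (k +d -1d)        ≡⟨ cong (k +d_) (⁻¹-∙-comm k -1d) ⟨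
    k +d (negd k +d negd -1d)   ≡⟨ \\-leftDividesˡ k (negd -1d) ⟩
    negd -1d                    ≡⟨ ⁻¹-involutive 1d ⟩
    1d                          ∎

  r-reflection : ∀ p k → IsReflection (r p k)
  r-reflection τ₀₁ k = zero , suc zero , k , (λ ()) , refl
  r-reflection τ₀₂ k = zero , suc (suc zero) , k , (λ ()) , refl
  r-reflection τ₁₂ k = suc zero , suc (suc zero) , k , (λ ()) , refl

  ReflLength-r : ∀ p k → ReflLength (r p k) 1
  ReflLength-r τ₀₁ k = ReflLength-reflection (r-reflection τ₀₁ k) (λ ())
  ReflLength-r τ₀₂ k = ReflLength-reflection (r-reflection τ₀₂ k) (λ ())
  ReflLength-r τ₁₂ k = ReflLength-reflection (r-reflection τ₁₂ k) (λ ())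

  r-involutive : ∀ p k → r p k · r p k ≡ ε
  r-involutive τ₀₁ k = weights≡ (negd-inverseʳ k) (negd-inverseˡ k) refl
  r-involutive τ₀₂ k = weights≡ (negd-inverseʳ k) refl (negd-inverseˡ k)
  r-involutive τ₁₂ k = weights≡ refl (negd-inverseʳ k) (negd-inverseˡ k)

  reflection-normal : ∀ {t} → IsReflection t → ∃₂ λ p k → t ≡ r p k
  reflection-normal (zero , suc zero , k , _ , refl)             = τ₀₁ , k , refl
  reflection-normal (zero , suc (suc zero) , k , _ , refl)       = τ₀₂ , k , refl
  reflection-normal (suc zero , suc (suc zero) , k , _ , refl)   = τ₁₂ , k , refl
  reflection-normal (suc zero , zero , k , _ , refl)             = τ₀₁ , negd k , weights≡ refl (sym (⁻¹-involutive k)) refl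
  reflection-normal (suc (suc zero) , zero , k , _ , refl)       = τ₀₂ , negd k , weights≡ refl refl (sym (⁻¹-involutive k))
  reflection-normal (suc (suc zero) , suc zero , k , _ , refl)   = τ₁₂ , negd k , weights≡ refl refl (sym (⁻¹-involutive k))
  reflection-normal (zero , zero , _ , i≢j , _)                   = ⊥-elim (i≢j refl)
  reflection-normal (suc zero , suc zero , _ , i≢j , _)           = ⊥-elim (i≢j refl)
  reflection-normal (suc (suc zero) , suc (suc zero) , _ , i≢j , _) = ⊥-elim (i≢j refl)

  -- A reflection permutes two coordinates and has weight 0 on the third.
  not-reflection : ∀ {u} → (∀ p → proj₁ u ≡ proj₁ (r p zero) → lookup (proj₂ u) (fixed p) ≢ zero) →
                   ¬ IsReflection u
  not-reflection weight≢0 u∈T with reflection-normal u∈T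
  ... | τ₀₁ , _ , refl = weight≢0 τ₀₁ refl refl
  ... | τ₀₂ , _ , refl = weight≢0 τ₀₂ refl refl
  ... | τ₁₂ , _ , refl = weight≢0 τ₁₂ refl refl

  -- The permutation of c is a transposition, that of a product of two reflections is even.
  two-reflections-even : ∀ p k p′ k′ → proj₁ (r p k · r p′ k′) ≢ proj₁ c
  two-reflections-even τ₀₁ _ τ₀₁ _ ()
  two-reflections-even τ₀₁ _ τ₀₂ _ ()
  two-reflections-even τ₀₁ _ τ₁₂ _ ()
  two-reflections-even τ₀₂ _ τ₀₁ _ ()
  two-reflections-even τ₀₂ _ τ₀₂ _ ()
  two-reflections-even τ₀₂ _ τ₁₂ _ ()
  two-reflections-even τ₁₂ _ τ₀₁ _ ()
  two-reflections-even τ₁₂ _ τ₀₂ _ ()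
  two-reflections-even τ₁₂ _ τ₁₂ _ ()

  two-reflections-diagonal : ∀ p k p′ k′ → proj₁ (r p k · r p′ k′) ≡ proj₁ ε →
                             ∃ λ i → lookup (proj₂ (r p k · r p′ k′)) i ≡ zero
  two-reflections-diagonal τ₀₁ _ τ₀₁ _ _ = fixed τ₀₁ , refl
  two-reflections-diagonal τ₀₂ _ τ₀₂ _ _ = fixed τ₀₂ , refl
  two-reflections-diagonal τ₁₂ _ τ₁₂ _ _ = fixed τ₁₂ , refl
  two-reflections-diagonal τ₀₁ _ τ₀₂ _ ()
  two-reflections-diagonal τ₀₁ _ τ₁₂ _ ()
  two-reflections-diagonal τ₀₂ _ τ₀₁ _ ()
  two-reflections-diagonal τ₀₂ _ τ₁₂ _ ()
  two-reflections-diagonal τ₁₂ _ τ₀₁ _ ()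
  two-reflections-diagonal τ₁₂ _ τ₀₂ _ ()

  diagonal-has-zero : ∀ {u} → ReflLength u 2 → proj₁ u ≡ proj₁ ε → ∃ λ i → lookup (proj₂ u) i ≡ zero
  diagonal-has-zero ru diagonal with ProductOfReflections₂⇒factors (proj₁ ru)
  ... | t , t′ , t∈T , t′∈T , refl with reflection-normal t∈T | reflection-normal t′∈T
  ...   | p , k , refl | p′ , k′ , refl = two-reflections-diagonal p k p′ k′ diagonal

  r01-0·r02 : ∀ k → r τ₀₁ zero · r τ₀₂ k ≡ A k
  r01-0·r02 k = weights≡ refl (-0+a≡a k) (+d-identityˡ (negd k))

  r02·r12 : ∀ k → r τ₀₂ k · r τ₁₂ k ≡ A k
  r02·r12 k = weights≡ (negd-inverseʳ k) (+d-identityˡ k) (+d-identityʳ (negd k))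

  r12·r01-0 : ∀ k → r τ₁₂ k · r τ₀₁ zero ≡ A k
  r12·r01-0 k = weights≡ refl (+d-identityʳ k) (a-0≡a (negd k))

  r02-1·r02-0 : r τ₀₂ 1d · r τ₀₂ zero ≡ D₁
  r02-1·r02-0 = weights≡ (a-0≡a 1d) refl (+d-identityʳ -1d)

  r12-0·r12-[-1] : r τ₁₂ zero · r τ₁₂ -1d ≡ D₀
  r12-0·r12-[-1] = weights≡ refl 0+-[-1]≡1 (-0+a≡a -1d)

  r02·r01-[-1] : ∀ j → r τ₀₂ j · r τ₀₁ -1d ≡ B j
  r02·r01-[-1] j = weights≡ (+d-identityʳ j) 0+-[-1]≡1 (+d-comm (negd j) -1d)

  r12-1·r02-0 : r τ₁₂ 1d · r τ₀₂ zero ≡ B zero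
  r12-1·r02-0 = weights≡ refl (a-0≡a 1d) (trans (+d-identityʳ -1d) (sym (a-0≡a -1d)))

  r01-[-1]·r12 : ∀ j → r τ₀₁ -1d · r τ₁₂ (1d +d j) ≡ B j
  r01-[-1]·r12 j = weights≡ (\\-leftDividesʳ 1d j) -[-1]+0≡1 (trans (+d-identityˡ _) (sym (⁻¹-∙-comm 1d j)))

  r01-0·D₁ : r τ₀₁ zero · D₁ ≡ c
  r01-0·D₁ = weights≡ refl (-0+a≡a 1d) (+d-identityˡ -1d)

  r01-[-1]·D₀ : r τ₀₁ -1d · D₀ ≡ c
  r01-[-1]·D₀ = weights≡ (negd-inverseˡ 1d) -[-1]+0≡1 (+d-identityˡ -1d)

  r02·B : ∀ k → r τ₀₂ k · B (k +d -1d) ≡ c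
  r02·B k = weights≡ (trans (sym (+d-assoc k -1d _)) (negd-inverseʳ (k +d -1d))) refl (\\-leftDividesʳ k -1d)

  r12·A : ∀ k → r τ₁₂ k · A (k +d -1d) ≡ c
  r12·A k = weights≡ refl (k+-[k-1]≡1 k) (\\-leftDividesʳ k -1d)

  c·r01-0 : c · r τ₀₁ zero ≡ D₀
  c·r01-0 = weights≡ (trans (+d-identityˡ _) ε⁻¹≈ε) (+d-identityʳ 1d) (+d-identityʳ -1d)

  c·r01-[-1] : c · r τ₀₁ -1d ≡ D₁
  c·r01-[-1] = weights≡ 0+-[-1]≡1 (negd-inverseʳ 1d) (+d-identityʳ -1d)

  c·r02 : ∀ k → c · r τ₀₂ k ≡ A (1d +d k)
  c·r02 k = weights≡ refl refl (⁻¹-∙-comm 1d k)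

  c·r12 : ∀ j → c · r τ₁₂ j ≡ B j
  c·r12 j = weights≡ (+d-identityˡ j) (+d-identityʳ 1d) refl

  ReflLength-c : ReflLength c 3
  ReflLength-c =
    ( (r τ₀₁ zero ∷ r τ₀₂ 1d ∷ r τ₀₂ zero ∷ [])
    , (r-reflection τ₀₁ zero ∷ r-reflection τ₀₂ 1d ∷ r-reflection τ₀₂ zero ∷ [])
    , refl
    , trans (cong (λ v → r τ₀₁ zero · (r τ₀₂ 1d · v)) (·-identityʳ (r τ₀₂ zero)))
            (trans (cong (r τ₀₁ zero ·_) r02-1·r02-0) r01-0·D₁))
    , shorter
    where
    shorter : ∀ m → ℕ.suc m ≤ 3 → ¬ ProductOfReflections m c
    shorter 0 _ p with ProductOfReflections₀⇒≡ε p
    ... | ()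
    shorter 1 _ p = not-reflection (λ { τ₀₁ _ → -1d≢0 ; τ₀₂ () ; τ₁₂ () }) (ProductOfReflections₁⇒reflection p)
    shorter 2 _ p with ProductOfReflections₂⇒factors p
    ... | t , t′ , t∈T , t′∈T , tt′≡c with reflection-normal t∈T | reflection-normal t′∈T
    ...   | p , k , refl | p′ , k′ , refl = two-reflections-even p k p′ k′ (cong proj₁ tt′≡c)
    shorter (ℕ.suc (ℕ.suc (ℕ.suc _))) (s≤s (s≤s (s≤s ())))

  ReflLength-D₀ : ReflLength D₀ 2
  ReflLength-D₀ = ReflLength-product (r-reflection τ₁₂ zero) (r-reflection τ₁₂ -1d) r12-0·r12-[-1] (λ ())
                    (not-reflection λ { τ₀₁ () ; τ₀₂ () ; τ₁₂ () })

  ReflLength-D₁ : ReflLength D₁ 2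
  ReflLength-D₁ = ReflLength-product (r-reflection τ₀₂ 1d) (r-reflection τ₀₂ zero) r02-1·r02-0 (λ ())
                    (not-reflection λ { τ₀₁ () ; τ₀₂ () ; τ₁₂ () })

  ReflLength-A : ∀ k → ReflLength (A k) 2
  ReflLength-A k = ReflLength-product (r-reflection τ₀₁ zero) (r-reflection τ₀₂ k) (r01-0·r02 k) (λ ())
                     (not-reflection λ { τ₀₁ () ; τ₀₂ () ; τ₁₂ () })

  ReflLength-B : ∀ j → ReflLength (B j) 2
  ReflLength-B j = ReflLength-product (r-reflection τ₀₂ j) (r-reflection τ₀₁ -1d) (r02·r01-[-1] j) (λ ())
                     (not-reflection λ { τ₀₁ () ; τ₀₂ () ; τ₁₂ () })

  reflection∈NC : ∀ p k {R} → r p k · R ≡ c → ReflLength R 2 → InNC c (r p k)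
  reflection∈NC p k tR≡c rR = ε≤T (ReflLength-r p k) , ≤T-intro tR≡c (ReflLength-r p k) rR ReflLength-c

  c·reflection∈NC : ∀ p k {R} → c · r p k ≡ R → ReflLength R 2 → InNC c R
  c·reflection∈NC p k ct≡R rR =
    ε≤T rR , ≤T-intro (sym (involution-cancelʳ {r p k} (r-involutive p k) ct≡R)) rR (ReflLength-r p k) ReflLength-c

  r01-0∈NC : InNC c (r τ₀₁ zero)
  r01-0∈NC = reflection∈NC τ₀₁ zero r01-0·D₁ ReflLength-D₁

  r01-[-1]∈NC : InNC c (r τ₀₁ -1d)
  r01-[-1]∈NC = reflection∈NC τ₀₁ -1d r01-[-1]·D₀ ReflLength-D₀

  r02∈NC : ∀ k → InNC c (r τ₀₂ k)
  r02∈NC k = reflection∈NC τ₀₂ k (r02·B k) (ReflLength-B (k +d -1d))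

  r12∈NC : ∀ k → InNC c (r τ₁₂ k)
  r12∈NC k = reflection∈NC τ₁₂ k (r12·A k) (ReflLength-A (k +d -1d))

  D₀∈NC : InNC c D₀
  D₀∈NC = c·reflection∈NC τ₀₁ zero c·r01-0 ReflLength-D₀

  D₁∈NC : InNC c D₁
  D₁∈NC = c·reflection∈NC τ₀₁ -1d c·r01-[-1] ReflLength-D₁

  A∈NC : ∀ k → InNC c (A k)
  A∈NC k = c·reflection∈NC τ₀₂ (k +d -1d) (trans (c·r02 (k +d -1d)) (cong A 1+[k-1]≡k)) (ReflLength-A k)
    where
    1+[k-1]≡k : 1d +d (k +d -1d) ≡ k
    1+[k-1]≡k = trans (+d-comm 1d (k +d -1d)) (//-rightDividesˡ 1d k)

  B∈NC : ∀ j → InNC c (B j)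
  B∈NC j = c·reflection∈NC τ₁₂ j (c·r12 j) (ReflLength-B j)

  ε∈NC : InNC c ε
  ε∈NC = ≤T-refl ReflLength-ε , ε≤T ReflLength-c

  c∈NC : InNC c c
  c∈NC = ε≤T ReflLength-c , ≤T-refl ReflLength-c

  factor≤T : ∀ p k p′ k′ {R} → r p k · r p′ k′ ≡ R → ReflLength R 2 → r p k ≤T R
  factor≤T p k p′ k′ eq rR = ≤T-intro eq (ReflLength-r p k) (ReflLength-r p′ k′) rR

  quotient∉T⇒≰T : ∀ p k {R} → ReflLength R 2 → ¬ IsReflection (r p k · R) → ¬ r p k ≤T R
  quotient∉T⇒≰T p k rR quotient∉T t≤R =
    quotient∉T (ProductOfReflections₁⇒reflection (proj₁ (involution-quotient (r-involutive p k) t≤R (ReflLength-r p k) rR)))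

  open NoncrossingParts c ReflLength-c

  pattern ∅₃    = outside ∷ outside ∷ outside ∷ []
  pattern ⁅0⁆   = inside  ∷ outside ∷ outside ∷ []
  pattern ⁅1⁆   = outside ∷ inside  ∷ outside ∷ []
  pattern ⁅2⁆   = outside ∷ outside ∷ inside  ∷ []
  pattern ⁅01⁆  = inside  ∷ inside  ∷ outside ∷ []
  pattern ⁅02⁆  = inside  ∷ outside ∷ inside  ∷ []
  pattern ⁅12⁆  = outside ∷ inside  ∷ inside  ∷ []
  pattern ⁅012⁆ = inside  ∷ inside  ∷ inside  ∷ []

  cube : Subset 3 → Elem 3 d
  cube ∅₃    = ε
  cube ⁅0⁆   = r τ₀₁ zero
  cube ⁅1⁆   = r τ₀₂ zero
  cube ⁅2⁆   = r τ₁₂ 1d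
  cube ⁅01⁆  = A zero
  cube ⁅02⁆  = A 1d
  cube ⁅12⁆  = B zero
  cube ⁅012⁆ = c

  cube-rank : ∀ X → ReflLength (cube X) (∣ X ∣ + 0)
  cube-rank ∅₃    = ReflLength-ε
  cube-rank ⁅0⁆   = ReflLength-r τ₀₁ zero
  cube-rank ⁅1⁆   = ReflLength-r τ₀₂ zero
  cube-rank ⁅2⁆   = ReflLength-r τ₁₂ 1d
  cube-rank ⁅01⁆  = ReflLength-A zero
  cube-rank ⁅02⁆  = ReflLength-A 1d
  cube-rank ⁅12⁆  = ReflLength-B zero
  cube-rank ⁅012⁆ = ReflLength-c

  cube-inNC : ∀ X → InNC c (cube X)
  cube-inNC ∅₃    = ε∈NC
  cube-inNC ⁅0⁆   = r01-0∈NC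
  cube-inNC ⁅1⁆   = r02∈NC zero
  cube-inNC ⁅2⁆   = r12∈NC 1d
  cube-inNC ⁅01⁆  = A∈NC zero
  cube-inNC ⁅02⁆  = A∈NC 1d
  cube-inNC ⁅12⁆  = B∈NC zero
  cube-inNC ⁅012⁆ = c∈NC

  cube-intermediate : ∀ X Y → ∣ X ∣ ≤ ∣ Y ∣ → Intermediate X → Intermediate Y → X ⊆ Y ⇔ cube X ≤T cube Y
  cube-intermediate ∅₃ _ _ (() , _) _
  cube-intermediate ⁅012⁆ _ _ (_ , s≤s (s≤s (s≤s ()))) _
  cube-intermediate ⁅0⁆ ∅₃ () _ _
  cube-intermediate ⁅0⁆ ⁅0⁆ _ _ _ = comparable _ (≤T-refl (cube-rank ⁅0⁆))
  cube-intermediate ⁅0⁆ ⁅1⁆ _ _ _ = incomparable _ (same-rank⇒¬≤T (cube-rank ⁅0⁆) (cube-rank ⁅1⁆) λ ())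
  cube-intermediate ⁅0⁆ ⁅2⁆ _ _ _ = incomparable _ (same-rank⇒¬≤T (cube-rank ⁅0⁆) (cube-rank ⁅2⁆) λ ())
  cube-intermediate ⁅0⁆ ⁅12⁆ _ _ _ = incomparable _ (quotient∉T⇒≰T τ₀₁ zero (ReflLength-B zero) (not-reflection λ { τ₀₁ () ; τ₀₂ () ; τ₁₂ _ () }))
  cube-intermediate ⁅0⁆ ⁅02⁆ _ _ _ = comparable _ (factor≤T τ₀₁ zero τ₀₂ 1d (r01-0·r02 1d) (ReflLength-A 1d))
  cube-intermediate ⁅0⁆ ⁅01⁆ _ _ _ = comparable _ (factor≤T τ₀₁ zero τ₀₂ zero (r01-0·r02 zero) (ReflLength-A zero))
  cube-intermediate ⁅0⁆ ⁅012⁆ _ _ (_ , s≤s (s≤s (s≤s ())))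
  cube-intermediate ⁅1⁆ ∅₃ () _ _
  cube-intermediate ⁅1⁆ ⁅0⁆ _ _ _ = incomparable _ (same-rank⇒¬≤T (cube-rank ⁅1⁆) (cube-rank ⁅0⁆) λ ())
  cube-intermediate ⁅1⁆ ⁅1⁆ _ _ _ = comparable _ (≤T-refl (cube-rank ⁅1⁆))
  cube-intermediate ⁅1⁆ ⁅2⁆ _ _ _ = incomparable _ (same-rank⇒¬≤T (cube-rank ⁅1⁆) (cube-rank ⁅2⁆) λ ())
  cube-intermediate ⁅1⁆ ⁅12⁆ _ _ _ = comparable _ (factor≤T τ₀₂ zero τ₀₁ -1d (r02·r01-[-1] zero) (ReflLength-B zero))
  cube-intermediate ⁅1⁆ ⁅02⁆ _ _ _ = incomparable _ (quotient∉T⇒≰T τ₀₂ zero (ReflLength-A 1d) (not-reflection λ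
      { τ₀₁ () ; τ₀₂ () ; τ₁₂ _ w≡0 → -1d≢0 (trans (sym (+d-identityˡ -1d)) w≡0) }))
  cube-intermediate ⁅1⁆ ⁅01⁆ _ _ _ = comparable _ (factor≤T τ₀₂ zero τ₁₂ zero (r02·r12 zero) (ReflLength-A zero))
  cube-intermediate ⁅1⁆ ⁅012⁆ _ _ (_ , s≤s (s≤s (s≤s ())))
  cube-intermediate ⁅2⁆ ∅₃ () _ _
  cube-intermediate ⁅2⁆ ⁅0⁆ _ _ _ = incomparable _ (same-rank⇒¬≤T (cube-rank ⁅2⁆) (cube-rank ⁅0⁆) λ ())
  cube-intermediate ⁅2⁆ ⁅1⁆ _ _ _ = incomparable _ (same-rank⇒¬≤T (cube-rank ⁅2⁆) (cube-rank ⁅1⁆) λ ())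
  cube-intermediate ⁅2⁆ ⁅2⁆ _ _ _ = comparable _ (≤T-refl (cube-rank ⁅2⁆))
  cube-intermediate ⁅2⁆ ⁅12⁆ _ _ _ = comparable _ (factor≤T τ₁₂ 1d τ₀₂ zero r12-1·r02-0 (ReflLength-B zero))
  cube-intermediate ⁅2⁆ ⁅02⁆ _ _ _ = comparable _ (factor≤T τ₁₂ 1d τ₀₁ zero (r12·r01-0 1d) (ReflLength-A 1d))
  cube-intermediate ⁅2⁆ ⁅01⁆ _ _ _ = incomparable _ (quotient∉T⇒≰T τ₁₂ 1d (ReflLength-A zero) (not-reflection λ
      { τ₀₁ _ w≡0 → -1d≢0 (trans (sym (+d-identityʳ -1d)) w≡0) ; τ₀₂ () ; τ₁₂ () }))
  cube-intermediate ⁅2⁆ ⁅012⁆ _ _ (_ , s≤s (s≤s (s≤s ())))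
  cube-intermediate ⁅12⁆ ∅₃ () _ _
  cube-intermediate ⁅12⁆ ⁅0⁆ (s≤s ()) _ _
  cube-intermediate ⁅12⁆ ⁅1⁆ (s≤s ()) _ _
  cube-intermediate ⁅12⁆ ⁅2⁆ (s≤s ()) _ _
  cube-intermediate ⁅12⁆ ⁅12⁆ _ _ _ = comparable _ (≤T-refl (cube-rank ⁅12⁆))
  cube-intermediate ⁅12⁆ ⁅02⁆ _ _ _ = incomparable _ (same-rank⇒¬≤T (cube-rank ⁅12⁆) (cube-rank ⁅02⁆) λ ())
  cube-intermediate ⁅12⁆ ⁅01⁆ _ _ _ = incomparable _ (same-rank⇒¬≤T (cube-rank ⁅12⁆) (cube-rank ⁅01⁆) λ ())
  cube-intermediate ⁅12⁆ ⁅012⁆ _ _ (_ , s≤s (s≤s (s≤s ())))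
  cube-intermediate ⁅02⁆ ∅₃ () _ _
  cube-intermediate ⁅02⁆ ⁅0⁆ (s≤s ()) _ _
  cube-intermediate ⁅02⁆ ⁅1⁆ (s≤s ()) _ _
  cube-intermediate ⁅02⁆ ⁅2⁆ (s≤s ()) _ _
  cube-intermediate ⁅02⁆ ⁅12⁆ _ _ _ = incomparable _ (same-rank⇒¬≤T (cube-rank ⁅02⁆) (cube-rank ⁅12⁆) λ ())
  cube-intermediate ⁅02⁆ ⁅02⁆ _ _ _ = comparable _ (≤T-refl (cube-rank ⁅02⁆))
  cube-intermediate ⁅02⁆ ⁅01⁆ _ _ _ = incomparable _ (same-rank⇒¬≤T (cube-rank ⁅02⁆) (cube-rank ⁅01⁆) λ ())
  cube-intermediate ⁅02⁆ ⁅012⁆ _ _ (_ , s≤s (s≤s (s≤s ())))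
  cube-intermediate ⁅01⁆ ∅₃ () _ _
  cube-intermediate ⁅01⁆ ⁅0⁆ (s≤s ()) _ _
  cube-intermediate ⁅01⁆ ⁅1⁆ (s≤s ()) _ _
  cube-intermediate ⁅01⁆ ⁅2⁆ (s≤s ()) _ _
  cube-intermediate ⁅01⁆ ⁅12⁆ _ _ _ = incomparable _ (same-rank⇒¬≤T (cube-rank ⁅01⁆) (cube-rank ⁅12⁆) λ ())
  cube-intermediate ⁅01⁆ ⁅02⁆ _ _ _ = incomparable _ (same-rank⇒¬≤T (cube-rank ⁅01⁆) (cube-rank ⁅02⁆) λ ())
  cube-intermediate ⁅01⁆ ⁅01⁆ _ _ _ = comparable _ (≤T-refl (cube-rank ⁅01⁆))
  cube-intermediate ⁅01⁆ ⁅012⁆ _ _ (_ , s≤s (s≤s (s≤s ())))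

  Index : Set
  Index = Fin d ⊎ Fin d

  size : Index → ℕ
  size (inj₁ zero)    = 3
  size (inj₁ (suc _)) = 1
  size (inj₂ _)       = 1

  part : (i : Index) → Subset (size i) → Elem 3 d
  part (inj₁ zero)          = cube
  part (inj₁ (suc zero))    = edge (r τ₀₂ 1d) D₁
  part (inj₁ (suc (suc k))) = edge (r τ₀₂ (suc (suc k))) (B (suc (suc k)))
  part (inj₂ zero)          = edge (r τ₁₂ zero) D₀
  part (inj₂ (suc zero))    = edge (r τ₀₁ -1d) (B 1d)
  part (inj₂ (suc (suc k))) = edge (r τ₁₂ (suc (suc k))) (A (suc (suc k)))

  part-inNC : ∀ i X → InNC c (part i X)
  part-inNC (inj₁ zero)          X              = cube-inNC X
  part-inNC (inj₁ (suc zero))    (outside ∷ []) = r02∈NC 1d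
  part-inNC (inj₁ (suc zero))    (inside ∷ [])  = D₁∈NC
  part-inNC (inj₁ (suc (suc k))) (outside ∷ []) = r02∈NC (suc (suc k))
  part-inNC (inj₁ (suc (suc k))) (inside ∷ [])  = B∈NC (suc (suc k))
  part-inNC (inj₂ zero)          (outside ∷ []) = r12∈NC zero
  part-inNC (inj₂ zero)          (inside ∷ [])  = D₀∈NC
  part-inNC (inj₂ (suc zero))    (outside ∷ []) = r01-[-1]∈NC
  part-inNC (inj₂ (suc zero))    (inside ∷ [])  = B∈NC 1d
  part-inNC (inj₂ (suc (suc k))) (outside ∷ []) = r12∈NC (suc (suc k))
  part-inNC (inj₂ (suc (suc k))) (inside ∷ [])  = A∈NC (suc (suc k))

  edge-part : ∀ p k p′ k′ {R} → r p k · r p′ k′ ≡ R → ReflLength R 2 → InNC c (r p k) → InNC c R →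
              IsSymmetricBooleanPart (Image (edge (r p k) R))
  edge-part p k p′ k′ eq rR t∈ R∈ = edgePart t∈ R∈ (ReflLength-r p k) rR (factor≤T p k p′ k′ eq rR) refl

  parts : ∀ i → IsSymmetricBooleanPart (Image (part i))
  parts (inj₁ zero) =
    BooleanPart.isSymmetricBooleanPart cube 0 cube-rank cube-inNC
      (λ Y → ε≤T (cube-rank Y)) (λ X → proj₂ (cube-inNC X)) cube-intermediate refl
  parts (inj₁ (suc zero)) = edge-part τ₀₂ 1d τ₀₂ zero r02-1·r02-0 ReflLength-D₁ (r02∈NC 1d) D₁∈NC
  parts (inj₁ (suc (suc k))) =
    edge-part τ₀₂ (suc (suc k)) τ₀₁ -1d (r02·r01-[-1] (suc (suc k))) (ReflLength-B _) (r02∈NC _) (B∈NC _)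
  parts (inj₂ zero) = edge-part τ₁₂ zero τ₁₂ -1d r12-0·r12-[-1] ReflLength-D₀ (r12∈NC zero) D₀∈NC
  parts (inj₂ (suc zero)) = edge-part τ₀₁ -1d τ₁₂ (1d +d 1d) (r01-[-1]·r12 1d) (ReflLength-B 1d) r01-[-1]∈NC (B∈NC 1d)
  parts (inj₂ (suc (suc k))) =
    edge-part τ₁₂ (suc (suc k)) τ₀₁ zero (r12·r01-0 (suc (suc k))) (ReflLength-A _) (r12∈NC _) (A∈NC _)

  -- Only the values on NC(c) matter.
  locate : Elem 3 d → Index
  locate (id₃  , zero    ∷ zero    ∷ _ ∷ []) = inj₁ zero
  locate (id₃  , zero    ∷ suc _   ∷ _ ∷ []) = inj₂ zero
  locate (id₃  , suc _   ∷ _       ∷ _ ∷ []) = inj₁ (suc zero)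
  locate (π₀₁  , zero    ∷ _       ∷ _ ∷ []) = inj₁ zero
  locate (π₀₁  , suc _   ∷ _       ∷ _ ∷ []) = inj₂ (suc zero)
  locate (π₀₂  , k       ∷ _       ∷ _ ∷ []) = inj₁ k
  locate (π₁₂  , _       ∷ suc zero ∷ _ ∷ []) = inj₁ zero
  locate (π₁₂  , _       ∷ k       ∷ _ ∷ []) = inj₂ k
  locate (rot  , _       ∷ suc (suc k) ∷ _ ∷ []) = inj₂ (suc (suc k))
  locate (rot² , suc zero ∷ _      ∷ _ ∷ []) = inj₂ (suc zero)
  locate (rot² , k       ∷ _       ∷ _ ∷ []) = inj₁ k
  locate _                                   = inj₁ zero

  locate-r01-[-1] : locate (r τ₀₁ -1d) ≡ inj₂ (suc zero)
  locate-r01-[-1] with -1d | -1d≢0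
  ... | zero  | -1d≢0′ = ⊥-elim (-1d≢0′ refl)
  ... | suc _ | _      = refl

  locate-part : ∀ i X → locate (part i X) ≡ i
  locate-part (inj₁ zero)          ∅₃             = refl
  locate-part (inj₁ zero)          ⁅0⁆            = refl
  locate-part (inj₁ zero)          ⁅1⁆            = refl
  locate-part (inj₁ zero)          ⁅2⁆            = refl
  locate-part (inj₁ zero)          ⁅01⁆           = refl
  locate-part (inj₁ zero)          ⁅02⁆           = refl
  locate-part (inj₁ zero)          ⁅12⁆           = refl
  locate-part (inj₁ zero)          ⁅012⁆          = refl
  locate-part (inj₁ (suc zero))    (outside ∷ []) = refl
  locate-part (inj₁ (suc zero))    (inside ∷ [])  = refl
  locate-part (inj₁ (suc (suc k))) (outside ∷ []) = refl
  locate-part (inj₁ (suc (suc k))) (inside ∷ [])  = refl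
  locate-part (inj₂ zero)          (outside ∷ []) = refl
  locate-part (inj₂ zero)          (inside ∷ [])  = refl
  locate-part (inj₂ (suc zero))    (outside ∷ []) = locate-r01-[-1]
  locate-part (inj₂ (suc zero))    (inside ∷ [])  = refl
  locate-part (inj₂ (suc (suc k))) (outside ∷ []) = refl
  locate-part (inj₂ (suc (suc k))) (inside ∷ [])  = refl

  Located : Elem 3 d → Set
  Located x = ∃ λ i → Image (part i) x

  locate-r02 : ∀ k → Located (r τ₀₂ k)
  locate-r02 zero          = inj₁ zero , ⁅1⁆ , refl
  locate-r02 (suc zero)    = inj₁ (suc zero) , (outside ∷ []) , refl
  locate-r02 (suc (suc k)) = inj₁ (suc (suc k)) , (outside ∷ []) , refl

  locate-r12 : ∀ k → Located (r τ₁₂ k)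
  locate-r12 zero          = inj₂ zero , (outside ∷ []) , refl
  locate-r12 (suc zero)    = inj₁ zero , ⁅2⁆ , refl
  locate-r12 (suc (suc k)) = inj₂ (suc (suc k)) , (outside ∷ []) , refl

  locate-A : ∀ k → Located (A k)
  locate-A zero          = inj₁ zero , ⁅01⁆ , refl
  locate-A (suc zero)    = inj₁ zero , ⁅02⁆ , refl
  locate-A (suc (suc k)) = inj₂ (suc (suc k)) , (inside ∷ []) , refl

  locate-B : ∀ j → Located (B j)
  locate-B zero          = inj₁ zero , ⁅12⁆ , refl
  locate-B (suc zero)    = inj₂ (suc zero) , (inside ∷ []) , refl
  locate-B (suc (suc j)) = inj₁ (suc (suc j)) , (inside ∷ []) , refl

  negd≡0⇒≡0 : ∀ {k} → negd k ≡ zero → k ≡ zero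
  negd≡0⇒≡0 {k} -k≡0 = trans (sym (⁻¹-involutive k)) (trans (cong negd -k≡0) ε⁻¹≈ε)

  -- r τ₀₁ k · c is diagonal with weights (k + 1, - k, - 1); one of them must vanish.
  locate-r01 : ∀ k → (∃ λ i → lookup (proj₂ (r τ₀₁ k · c)) i ≡ zero) → Located (r τ₀₁ k)
  locate-r01 k (zero , k+1≡0) =
    subst (Located ∘ r τ₀₁) (sym (inverseˡ-unique k 1d k+1≡0)) (inj₂ (suc zero) , (outside ∷ []) , refl)
  locate-r01 k (suc zero , -k+0≡0) =
    subst (Located ∘ r τ₀₁) (sym (negd≡0⇒≡0 {k} (trans (sym (+d-identityʳ (negd k))) -k+0≡0))) (inj₁ zero , ⁅0⁆ , refl)
  locate-r01 k (suc (suc zero) , 0-1≡0) = ⊥-elim (-1d≢0 (trans (sym (+d-identityˡ -1d)) 0-1≡0))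

  -- c · r τ₀₁ k is diagonal with weights (- k, 1 + k, - 1); one of them must vanish.
  locate-c·r01 : ∀ k → (∃ λ i → lookup (proj₂ (c · r τ₀₁ k)) i ≡ zero) → Located (c · r τ₀₁ k)
  locate-c·r01 k (zero , 0-k≡0) =
    subst (Located ∘ (c ·_) ∘ r τ₀₁) (sym (negd≡0⇒≡0 {k} (trans (sym (+d-identityˡ (negd k))) 0-k≡0)))
          (subst Located (sym c·r01-0) (inj₂ zero , (inside ∷ []) , refl))
  locate-c·r01 k (suc zero , 1+k≡0) =
    subst (Located ∘ (c ·_) ∘ r τ₀₁) (sym (inverseʳ-unique 1d k 1+k≡0))
          (subst Located (sym c·r01-[-1]) (inj₁ (suc zero) , (inside ∷ []) , refl))
  locate-c·r01 k (suc (suc zero) , -1+0≡0) = ⊥-elim (-1d≢0 (trans (sym (+d-identityʳ -1d)) -1+0≡0))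

  locate-reflection : ∀ p k → r p k ≤T c → Located (r p k)
  locate-reflection τ₀₂ k _ = locate-r02 k
  locate-reflection τ₁₂ k _ = locate-r12 k
  locate-reflection τ₀₁ k t≤c =
    locate-r01 k (diagonal-has-zero (involution-quotient (r-involutive τ₀₁ k) t≤c (ReflLength-r τ₀₁ k) ReflLength-c) refl)

  locate-complement : ∀ p k → ReflLength (c · r p k) 2 → Located (c · r p k)
  locate-complement τ₀₂ k _  = subst Located (sym (c·r02 k)) (locate-A (1d +d k))
  locate-complement τ₁₂ k _  = subst Located (sym (c·r12 k)) (locate-B k)
  locate-complement τ₀₁ k rx = locate-c·r01 k (diagonal-has-zero rx refl)

  locate-rank1 : ∀ {x} → ReflLength x 1 → x ≤T c → Located x
  locate-rank1 rx x≤c =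
    let p , k , x≡t = reflection-normal (ProductOfReflections₁⇒reflection (proj₁ rx))
    in subst Located (sym x≡t) (locate-reflection p k (subst (_≤T c) x≡t x≤c))

  locate-rank2 : ∀ {x} → ReflLength x 2 → x ≤T c → Located x
  locate-rank2 {x} rx x≤c =
    let w , xw≡c , rw = ≤T-complement x≤c rx ReflLength-c
        p , k , w≡t = reflection-normal (ProductOfReflections₁⇒reflection (proj₁ rw))
        x≡c·t = involution-cancelʳ {r p k} (r-involutive p k) (subst (λ t → x · t ≡ c) w≡t xw≡c)
    in subst Located (sym x≡c·t) (locate-complement p k (subst (λ y → ReflLength y 2) x≡c·t rx))

  classify : ∀ x → InNC c x → Located x
  classify x x∈@(_ , x≤c) with InNC-rank x∈
  ... | 0 , _ , rx = inj₁ zero , ∅₃ , sym (ReflLength₀⇒≡ε rx)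
  ... | 1 , _ , rx = locate-rank1 rx x≤c
  ... | 2 , _ , rx = locate-rank2 rx x≤c
  ... | 3 , _ , rx = inj₁ zero , ⁅012⁆ , sym (≤T-same-rank x≤c rx ReflLength-c)
  ... | ℕ.suc (ℕ.suc (ℕ.suc (ℕ.suc _))) , s≤s (s≤s (s≤s ())) , _

  decomposition : GroupGdd.HasSymmetricBooleanDecomposition 3 d c
  decomposition = Assembly.decomposition +↔⊎ size part locate locate-part part-inNC classify parts

lemma3p20 : (d : ℕ) .{{_ : NonZero d}} → 2 ≤ d →
    GroupGdd.HasSymmetricBooleanDecomposition 2 d (coxeter2 d)
    × GroupGdd.HasSymmetricBooleanDecomposition 3 d (coxeter3 d)
lemma3p20 (ℕ.suc (ℕ.suc e)) _ = Gdd2.decomposition e , Gdd3.decomposition e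
lemma3p20 1 (s≤s ())
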